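{- Let $G$ be a finite, simple, connected bipartite graph with bipartition $(U,W)$, not isomorphic to $K_2$. If there exists a vertex $v$ such that $d_G(v)\notin\{d_G(x): x\in N(v)\}$ and the graph $G-v-N(v)$ (obtained by deleting $v$ and all its neighbors) is connected, then $G$ admits a vertex-coloring $2$-edge-weighting.
   Context: A $k$-edge-weighting of $G$ is a map $w:E(G)\to\{1,\dots,k\}$; it induces the vertex coloring $c(u)=\sum_{e\ni u} w(e)$ for $u\in V(G)$. The edge-weighting is vertex-coloring if $c(u)\ne c(v)$ for every edge $uv\in E(G)$. $N(v)$ denotes the set of neighbors of $v$ and $d_G(v)$ its degree. -}

module Defs where

open import Data.Nat using (ℕ; zero; suc; _+_; _≤_)
open import Data.Fin using (Fin)
open import Data.Bool using (Bool; true; false; if_then_else_)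
open import Data.List using (List; []; _∷_; map; allFin)
open import Data.Nat.ListAction using (sum)
open import Data.Unit using (⊤)
open import Data.Product using (Σ; _×_; _,_)
open import Data.Sum using (_⊎_)
open import Relation.Binary.PropositionalEquality using (_≡_; _≢_)
open import Relation.Nullary using (¬_)
open import Function.Bundles using (_↔_; Inverse)

record Graph (n : ℕ) : Set where
  field
    adj     : Fin n → Fin n → Bool
    symm    : ∀ u v → adj u v ≡ adj v u
    irrefl  : ∀ u → adj u u ≡ false

open Graph public

module _ {n : ℕ} (G : Graph n) where

  Adj : Fin n → Fin n → Set
  Adj u v = adj G u v ≡ true

  degree : Fin n → ℕ
  degree u = sum (map (λ v → if adj G u v then 1 else 0) (allFin n))

  data WalkIn (P : Fin n → Set) : Fin n → Fin n → Set where
    here : ∀ {u} → P u → WalkIn P u u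
    step : ∀ {u v x} → P u → Adj u v → WalkIn P v x → WalkIn P u x

  ConnectedOn : (Fin n → Set) → Set
  ConnectedOn P = ∀ u v → P u → P v → WalkIn P u v

  Connected : Set
  Connected = ∀ u v → WalkIn (λ _ → ⊤) u v

  Bipartite : Set
  Bipartite = Σ (Fin n → Bool) λ side → ∀ u v → Adj u v → side u ≢ side v

  record EdgeWeighting (k : ℕ) : Set where
    field
      wt     : Fin n → Fin n → ℕ
      wsym   : ∀ u v → Adj u v → wt u v ≡ wt v u
      wrange : ∀ u v → Adj u v → (1 ≤ wt u v) × (wt u v ≤ k)

  open EdgeWeighting public

  colour : ∀ {k} → EdgeWeighting k → Fin n → ℕ
  colour w u = sum (map (λ v → if adj G u v then wt w u v else 0) (allFin n))

  VertexColouring : ∀ {k} → EdgeWeighting k → Set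
  VertexColouring w = ∀ u v → Adj u v → colour w u ≢ colour w v

K₂ : Graph 2
K₂ = record { adj = a ; symm = s ; irrefl = i }
  where
    a : Fin 2 → Fin 2 → Bool
    a Fin.zero Fin.zero = false
    a Fin.zero (Fin.suc Fin.zero) = true
    a (Fin.suc Fin.zero) Fin.zero = true
    a (Fin.suc Fin.zero) (Fin.suc Fin.zero) = false
    s : ∀ u v → a u v ≡ a v u
    s Fin.zero Fin.zero = _≡_.refl
    s Fin.zero (Fin.suc Fin.zero) = _≡_.refl
    s (Fin.suc Fin.zero) Fin.zero = _≡_.refl
    s (Fin.suc Fin.zero) (Fin.suc Fin.zero) = _≡_.refl
    i : ∀ u → a u u ≡ false
    i Fin.zero = _≡_.refl
    i (Fin.suc Fin.zero) = _≡_.refl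

Isomorphic : ∀ {m n} → Graph m → Graph n → Set
Isomorphic {m} {n} G H =
  Σ (Fin m ↔ Fin n) λ f → ∀ u v → adj G u v ≡ adj H (Inverse.to f u) (Inverse.to f v)

-- Weight the edges of a set F with 1 and all other edges with 2. Then the colour of a vertex
-- has the parity of its F-degree, and a vertex not touched by F has twice its degree as colour.
-- Let U be the side of v. If |U| is even, take for F a U-join of G (an edge set whose
-- odd-degree vertices are exactly those of U): colour parities separate U from the other side.
-- If |U| is odd, U ∖ {v} has even size and lies in H = G - v - N(v), so take a (U ∖ {v})-join
-- inside H: vertices other than v are still separated by parity, while v and its neighbours
-- meet only weight-2 edges and are separated by the degree hypothesis. In a connected graph a
-- T-join with |T| even is the mod-2 sum of walks from a fixed root to the vertices of T.
module Submission where

open import Defs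
open import Data.Nat as ℕ using (ℕ; zero; suc; z≤n; s≤s; parity)
open import Data.Nat.Properties using (*-cancelˡ-≡)
  renaming (*-zeroʳ to *-zeroʳ-ℕ; *-distribˡ-+ to ℕ-*-distribˡ-+)
open import Data.Nat.ListAction using (sum)
open import Data.Fin using (Fin; zero; suc; punchIn)
open import Data.Fin.Properties using (_≟_; any?; punchInᵢ≢i)
open import Data.Bool using (Bool; true; false; not; if_then_else_)
open import Data.Bool.Properties using (not-injective)
open import Data.List using ([]; _∷_; map; tabulate; allFin)
open import Data.List.Properties using (map-cong; map-tabulate)
-- The library gives _+_ and _*_ on parities the same precedence.
open import Data.Parity.Base using (Parity; 0ℙ; 1ℙ; _*_) renaming (_+_ to infixl 6 _+_)
open import Data.Parity.Properties as ℙ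
  using (+-assoc; +-comm; +-identityʳ; *-comm; *-zeroʳ; *-identityʳ; *-distribˡ-+; p+p≡0ℙ; +-homo-+)
open import Algebra.Properties.Semiring.Sum ℙ.+-*-semiring
  using ( sum-syntax; sum-cong-≗; sum-replicate-zero; sum-remove; ∑-distrib-+; ∑-comm
        ; *-distribˡ-sum; *-distribʳ-sum)
open import Data.Unit using (tt)
open import Data.Empty using (⊥; ⊥-elim)
open import Data.Product using (Σ; Σ-syntax; _×_; _,_; proj₁; proj₂)
open import Function using (_∘_)
open import Relation.Binary.PropositionalEquality
open import Relation.Nullary using (¬_; yes; no; does; contradiction)
open import Relation.Nullary.Decidable using (dec-true; dec-false; does-⇔)
open import Function.Bundles using (mk⇔)

δ : ∀ {n} → Fin n → Fin n → Parity
δ a b = if does (a ≟ b) then 1ℙ else 0ℙ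

module _ {n : ℕ} where

  δ-≡ : ∀ {a b : Fin n} → a ≡ b → δ a b ≡ 1ℙ
  δ-≡ {a} {b} a≡b = cong (if_then 1ℙ else 0ℙ) (dec-true (a ≟ b) a≡b)

  δ-≢ : ∀ {a b : Fin n} → a ≢ b → δ a b ≡ 0ℙ
  δ-≢ {a} {b} a≢b = cong (if_then 1ℙ else 0ℙ) (dec-false (a ≟ b) a≢b)

  δ-sym : ∀ (a b : Fin n) → δ a b ≡ δ b a
  δ-sym a b = cong (if_then 1ℙ else 0ℙ) (does-⇔ (mk⇔ sym sym) (a ≟ b) (b ≟ a))

  δ*δ≡0ℙ : ∀ (p q x y : Fin n) → (p ≡ x → q ≡ y → ⊥) → δ p x * δ q y ≡ 0ℙ
  δ*δ≡0ℙ p q x y h with p ≟ x | q ≟ y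
  ... | yes p≡x  | yes q≡y = ⊥-elim (h p≡x q≡y)
  ... | no _     | _       = refl
  ... | yes _    | no _    = refl

≢1ℙ⇒≡0ℙ : ∀ {p} → p ≢ 1ℙ → p ≡ 0ℙ
≢1ℙ⇒≡0ℙ {0ℙ} _  = refl
≢1ℙ⇒≡0ℙ {1ℙ} p≢1 = contradiction refl p≢1

∑-zero : ∀ {n} (f : Fin n → Parity) → (∀ i → f i ≡ 0ℙ) → ∑[ i < n ] f i ≡ 0ℙ
∑-zero {n} f f≗0 = trans (sum-cong-≗ f≗0) (sum-replicate-zero n)

∑-δ-sift : ∀ {n} (f : Fin n → Parity) (a : Fin n) → ∑[ b < n ] (f b * δ b a) ≡ f a
∑-δ-sift {suc n} f a = begin
  ∑[ b < suc n ] (f b * δ b a)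
    ≡⟨ sum-remove {i = a} (λ b → f b * δ b a) ⟩
  f a * δ a a + ∑[ i < n ] (f (punchIn a i) * δ (punchIn a i) a)
    ≡⟨ cong₂ _+_ (cong (f a *_) (δ-≡ {a = a} refl)) off-diagonal ⟩
  f a * 1ℙ + 0ℙ
    ≡⟨ trans (+-identityʳ _) (*-identityʳ (f a)) ⟩
  f a
    ∎
  where
  open ≡-Reasoning
  off-diagonal : ∑[ i < n ] (f (punchIn a i) * δ (punchIn a i) a) ≡ 0ℙ
  off-diagonal = ∑-zero _ λ i →
    trans (cong (f (punchIn a i) *_) (δ-≢ (punchInᵢ≢i a i))) (*-zeroʳ _)

∑-δ : ∀ {n} (a : Fin n) → ∑[ b < n ] δ a b ≡ 1ℙ
∑-δ a = trans (sum-cong-≗ (δ-sym a)) (∑-δ-sift (λ _ → 1ℙ) a)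

-- Edge sets are symmetric ℙ-valued adjacency matrices, so that △ is symmetric difference.
EdgeSet : ℕ → Set
EdgeSet n = Fin n → Fin n → Parity

∅ : ∀ {n} → EdgeSet n
∅ _ _ = 0ℙ

infixl 6 _△_

_△_ : ∀ {n} → EdgeSet n → EdgeSet n → EdgeSet n
(F △ F′) x y = F x y + F′ x y

edgeAt : ∀ {n} → Fin n → Fin n → EdgeSet n
edgeAt p q x y = δ p x * δ q y + δ q x * δ p y

degreeParity : ∀ {n} → EdgeSet n → Fin n → Parity
degreeParity {n} F u = ∑[ y < n ] F u y

module _ {n : ℕ} where

  degreeParity-∅ : ∀ u → degreeParity (∅ {n}) u ≡ 0ℙ
  degreeParity-∅ u = ∑-zero (∅ u) λ _ → refl

  degreeParity-△ : ∀ (F F′ : EdgeSet n) u →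
                   degreeParity (F △ F′) u ≡ degreeParity F u + degreeParity F′ u
  degreeParity-△ F F′ u = ∑-distrib-+ (F u) (F′ u)

  degreeParity-∑ : ∀ {m} (F : Fin m → EdgeSet n) u →
                   degreeParity (λ x y → ∑[ t < m ] F t x y) u ≡ ∑[ t < m ] degreeParity (F t) u
  degreeParity-∑ F u = ∑-comm (λ y t → F t u y)

  degreeParity-edgeAt : ∀ (p q u : Fin n) → degreeParity (edgeAt p q) u ≡ δ p u + δ q u
  degreeParity-edgeAt p q u = begin
    ∑[ y < n ] (δ p u * δ q y + δ q u * δ p y)
      ≡⟨ ∑-distrib-+ (λ y → δ p u * δ q y) (λ y → δ q u * δ p y) ⟩
    (∑[ y < n ] (δ p u * δ q y)) + (∑[ y < n ] (δ q u * δ p y))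
      ≡⟨ sym (cong₂ _+_ (*-distribˡ-sum (δ p u) (δ q)) (*-distribˡ-sum (δ q u) (δ p))) ⟩
    δ p u * (∑[ y < n ] δ q y) + δ q u * (∑[ y < n ] δ p y)
      ≡⟨ cong₂ _+_ (cong (δ p u *_) (∑-δ q)) (cong (δ q u *_) (∑-δ p)) ⟩
    δ p u * 1ℙ + δ q u * 1ℙ
      ≡⟨ cong₂ _+_ (*-identityʳ (δ p u)) (*-identityʳ (δ q u)) ⟩
    δ p u + δ q u
      ∎
    where open ≡-Reasoning

record InducedEdgeSet {n} (G : Graph n) (P : Fin n → Set) (F : EdgeSet n) : Set where
  field
    symmetric : ∀ x y → F x y ≡ F y x
    ⊆edges    : ∀ x y → ¬ Adj G x y → F x y ≡ 0ℙ
    ⊆vertices : ∀ x y → ¬ P x → F x y ≡ 0ℙ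

open InducedEdgeSet

module _ {n : ℕ} (G : Graph n) {P : Fin n → Set} where

  ∅-induced : InducedEdgeSet G P ∅
  ∅-induced = record
    { symmetric = λ _ _ → refl
    ; ⊆edges    = λ _ _ _ → refl
    ; ⊆vertices = λ _ _ _ → refl
    }

  △-induced : ∀ {F F′} → InducedEdgeSet G P F → InducedEdgeSet G P F′ → InducedEdgeSet G P (F △ F′)
  △-induced I I′ = record
    { symmetric = λ x y → cong₂ _+_ (symmetric I x y) (symmetric I′ x y)
    ; ⊆edges    = λ x y ¬a → cong₂ _+_ (⊆edges I x y ¬a) (⊆edges I′ x y ¬a)
    ; ⊆vertices = λ x y ¬p → cong₂ _+_ (⊆vertices I x y ¬p) (⊆vertices I′ x y ¬p)
    }

  ∑-induced : ∀ {m} {F : Fin m → EdgeSet n} → (∀ t → InducedEdgeSet G P (F t)) →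
              InducedEdgeSet G P (λ x y → ∑[ t < m ] F t x y)
  ∑-induced I = record
    { symmetric = λ x y → sum-cong-≗ λ t → symmetric (I t) x y
    ; ⊆edges    = λ x y ¬a → ∑-zero _ λ t → ⊆edges (I t) x y ¬a
    ; ⊆vertices = λ x y ¬p → ∑-zero _ λ t → ⊆vertices (I t) x y ¬p
    }

  edgeAt-induced : ∀ {p q} → Adj G p q → P p → P q → InducedEdgeSet G P (edgeAt p q)
  edgeAt-induced {p} {q} pq Pp Pq =
    record { symmetric = swap ; ⊆edges = edges ; ⊆vertices = vertices }
    where
    swap : ∀ x y → edgeAt p q x y ≡ edgeAt p q y x
    swap x y = trans (+-comm (δ p x * δ q y) (δ q x * δ p y))
                     (cong₂ _+_ (*-comm (δ q x) (δ p y)) (*-comm (δ p x) (δ q y)))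
    edges : ∀ x y → ¬ Adj G x y → edgeAt p q x y ≡ 0ℙ
    edges x y ¬xy = cong₂ _+_ (δ*δ≡0ℙ p q x y λ { refl refl → ¬xy pq })
                              (δ*δ≡0ℙ q p x y λ { refl refl → ¬xy (trans (symm G x y) pq) })
    vertices : ∀ x y → ¬ P x → edgeAt p q x y ≡ 0ℙ
    vertices x y ¬Px = cong₂ _+_ (δ*δ≡0ℙ p q x y λ { refl _ → ¬Px Pp })
                                 (δ*δ≡0ℙ q p x y λ { refl _ → ¬Px Pq })

  walk-start : ∀ {a b} → WalkIn G P a b → P a
  walk-start (here Pa)     = Pa
  walk-start (step Pa _ _) = Pa

  walkEdges : ∀ {a b} → WalkIn G P a b → EdgeSet n
  walkEdges (here _)                 = ∅
  walkEdges (step {u} {v} _ _ walk) = edgeAt u v △ walkEdges walk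

  walkEdges-induced : ∀ {a b} (walk : WalkIn G P a b) → InducedEdgeSet G P (walkEdges walk)
  walkEdges-induced (here _)          = ∅-induced
  walkEdges-induced (step Pu uv walk) =
    △-induced (edgeAt-induced uv Pu (walk-start walk)) (walkEdges-induced walk)

  degreeParity-walkEdges : ∀ {a b} (walk : WalkIn G P a b) u →
                           degreeParity (walkEdges walk) u ≡ δ a u + δ b u
  degreeParity-walkEdges {a} (here _) u = trans (degreeParity-∅ u) (sym (p+p≡0ℙ (δ a u)))
  degreeParity-walkEdges {a} {b} (step {v = c} _ _ walk) u = begin
    degreeParity (edgeAt a c △ walkEdges walk) u
      ≡⟨ degreeParity-△ (edgeAt a c) (walkEdges walk) u ⟩
    degreeParity (edgeAt a c) u + degreeParity (walkEdges walk) u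
      ≡⟨ cong₂ _+_ (degreeParity-edgeAt a c u) (degreeParity-walkEdges walk u) ⟩
    (δ a u + δ c u) + (δ c u + δ b u)
      ≡⟨ +-cancel-middle (δ a u) (δ c u) (δ b u) ⟩
    δ a u + δ b u
      ∎
    where
    open ≡-Reasoning
    +-cancel-middle : ∀ x y z → (x + y) + (y + z) ≡ x + z
    +-cancel-middle x y z = begin
      (x + y) + (y + z)  ≡⟨ +-assoc x y (y + z) ⟩
      x + (y + (y + z))  ≡⟨ cong (x +_) (sym (+-assoc y y z)) ⟩
      x + ((y + y) + z)  ≡⟨ cong (λ w → x + (w + z)) (p+p≡0ℙ y) ⟩
      x + z              ∎

  -- F is a T-join of G[P] for T = {t | τ t ≡ 1ℙ}.
  TJoinOf : (Fin n → Parity) → EdgeSet n → Set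
  TJoinOf τ F = InducedEdgeSet G P F × (∀ u → degreeParity F u ≡ τ u)

  module _ (connected : ConnectedOn G P)
           (τ : Fin n → Parity) (τ⊆P : ∀ t → τ t ≡ 1ℙ → P t) where

    private module Rooted (r : Fin n) (Pr : P r) where

      walkTo : ∀ t → τ t ≡ 1ℙ → WalkIn G P r t
      walkTo t τt = connected r t Pr (τ⊆P t τt)

      -- Matching on p = τ t (with the equation kept) provides the proof of P t needed for the walk.
      walkTerm : ∀ t p → τ t ≡ p → EdgeSet n
      walkTerm t 0ℙ _  = ∅
      walkTerm t 1ℙ τt = walkEdges (walkTo t τt)

      walkTerm-induced : ∀ t p τt → InducedEdgeSet G P (walkTerm t p τt)
      walkTerm-induced t 0ℙ _  = ∅-induced
      walkTerm-induced t 1ℙ τt = walkEdges-induced (walkTo t τt)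

      degreeParity-walkTerm : ∀ t p τt u → degreeParity (walkTerm t p τt) u ≡ p * (δ r u + δ t u)
      degreeParity-walkTerm t 0ℙ _  u = degreeParity-∅ u
      degreeParity-walkTerm t 1ℙ τt u = degreeParity-walkEdges (walkTo t τt) u

      -- r is an endpoint of |T| walks, an even number, and each t ∈ T of exactly one.
      join : EdgeSet n
      join x y = ∑[ t < n ] walkTerm t (τ t) refl x y

      join-tJoin : ∑[ t < n ] τ t ≡ 0ℙ → TJoinOf τ join
      join-tJoin even = ∑-induced (λ t → walkTerm-induced t (τ t) refl) , degreeParity-join
        where
        open ≡-Reasoning
        degreeParity-join : ∀ u → degreeParity join u ≡ τ u
        degreeParity-join u = begin
          degreeParity join u
            ≡⟨ degreeParity-∑ (λ t → walkTerm t (τ t) refl) u ⟩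
          ∑[ t < n ] degreeParity (walkTerm t (τ t) refl) u
            ≡⟨ sum-cong-≗ (λ t → degreeParity-walkTerm t (τ t) refl u) ⟩
          ∑[ t < n ] (τ t * (δ r u + δ t u))
            ≡⟨ sum-cong-≗ (λ t → *-distribˡ-+ (τ t) (δ r u) (δ t u)) ⟩
          ∑[ t < n ] (τ t * δ r u + τ t * δ t u)
            ≡⟨ ∑-distrib-+ (λ t → τ t * δ r u) (λ t → τ t * δ t u) ⟩
          (∑[ t < n ] (τ t * δ r u)) + (∑[ t < n ] (τ t * δ t u))
            ≡⟨ cong₂ _+_ (sym (*-distribʳ-sum (δ r u) τ)) (∑-δ-sift τ u) ⟩
          (∑[ t < n ] τ t) * δ r u + τ u
            ≡⟨ cong (λ s → s * δ r u + τ u) even ⟩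
          τ u
            ∎

    tJoin : ∑[ t < n ] τ t ≡ 0ℙ → Σ (EdgeSet n) (TJoinOf τ)
    tJoin even with any? (λ t → τ t ℙ.≟ 1ℙ)
    ... | yes (r , τr) = Rooted.join r (τ⊆P r τr) , Rooted.join-tJoin r (τ⊆P r τr) even
    ... | no ∄τ=1      =
      ∅ , ∅-induced , λ u → trans (degreeParity-∅ u) (sym (≢1ℙ⇒≡0ℙ λ τu → ∄τ=1 (u , τu)))

parity-sum-tabulate : ∀ {n} (f : Fin n → ℕ) → parity (sum (tabulate f)) ≡ ∑[ i < n ] parity (f i)
parity-sum-tabulate {zero}  f = refl
parity-sum-tabulate {suc n} f =
  trans (+-homo-+ (f zero) _) (cong (parity (f zero) +_) (parity-sum-tabulate (f ∘ suc)))

parity-sum-allFin : ∀ {n} (f : Fin n → ℕ) → parity (sum (map f (allFin n))) ≡ ∑[ i < n ] parity (f i)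
parity-sum-allFin f = trans (cong (parity ∘ sum) (map-tabulate (λ i → i) f)) (parity-sum-tabulate f)

sum-map-*ˡ : ∀ {A : Set} c (f : A → ℕ) xs → sum (map (λ x → c ℕ.* f x) xs) ≡ c ℕ.* sum (map f xs)
sum-map-*ˡ c f []       = sym (*-zeroʳ-ℕ c)
sum-map-*ˡ c f (x ∷ xs) =
  trans (cong (c ℕ.* f x ℕ.+_) (sum-map-*ˡ c f xs)) (sym (ℕ-*-distribˡ-+ c (f x) _))

weight : Parity → ℕ
weight 0ℙ = 2
weight 1ℙ = 1

weight-range : ∀ p → 1 ℕ.≤ weight p × weight p ℕ.≤ 2
weight-range 0ℙ = s≤s z≤n , s≤s (s≤s z≤n)
weight-range 1ℙ = s≤s z≤n , s≤s z≤n

parity-weight : ∀ p → parity (weight p) ≡ p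
parity-weight 0ℙ = refl
parity-weight 1ℙ = refl

module _ {n : ℕ} (G : Graph n) {P : Fin n → Set} {F : EdgeSet n} (induced : InducedEdgeSet G P F) where

  weighting : EdgeWeighting G 2
  weighting = record
    { wt     = λ x y → weight (F x y)
    ; wsym   = λ x y _ → cong weight (symmetric induced x y)
    ; wrange = λ x y _ → weight-range (F x y)
    }

  parity-colour : ∀ u → parity (colour G weighting u) ≡ degreeParity F u
  parity-colour u =
    trans (parity-sum-allFin (λ y → if adj G u y then weight (F u y) else 0)) (sum-cong-≗ parity-term)
    where
    parity-term : ∀ y → parity (if adj G u y then weight (F u y) else 0) ≡ F u y
    parity-term y with adj G u y in uy
    ... | true  = parity-weight (F u y)
    ... | false = sym (⊆edges induced u y λ u~y → contradiction (trans (sym u~y) uy) λ ())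

  colour-untouched : ∀ u → (∀ y → F u y ≡ 0ℙ) → colour G weighting u ≡ 2 ℕ.* degree G u
  colour-untouched u untouched =
    trans (cong sum (map-cong doubled (allFin n))) (sum-map-*ˡ 2 _ (allFin n))
    where
    doubled : ∀ y → (if adj G u y then weight (F u y) else 0) ≡ 2 ℕ.* (if adj G u y then 1 else 0)
    doubled y rewrite untouched y with adj G u y
    ... | true  = refl
    ... | false = refl

  colour-≢-by-parity : ∀ {u w} → degreeParity F u ≢ degreeParity F w →
                       colour G weighting u ≢ colour G weighting w
  colour-≢-by-parity {u} {w} u≢w cu≡cw =
    u≢w (trans (sym (parity-colour u)) (trans (cong parity cu≡cw) (parity-colour w)))

  colour-≢-by-degree : ∀ {u w} → (∀ y → F u y ≡ 0ℙ) → (∀ y → F w y ≡ 0ℙ) →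
                       degree G u ≢ degree G w → colour G weighting u ≢ colour G weighting w
  colour-≢-by-degree {u} {w} untouched-u untouched-w u≢w cu≡cw =
    u≢w (*-cancelˡ-≡ _ _ 2 (trans (sym (colour-untouched u untouched-u))
                                  (trans cu≡cw (colour-untouched w untouched-w))))

Bool→Parity : Bool → Parity
Bool→Parity false = 0ℙ
Bool→Parity true  = 1ℙ

Bool→Parity-injective : ∀ {a b} → Bool→Parity a ≡ Bool→Parity b → a ≡ b
Bool→Parity-injective {false} {false} _ = refl
Bool→Parity-injective {true}  {true}  _ = refl

module _ {n : ℕ} (G : Graph n) where

  ProperParityColouring : (Fin n → Parity) → Set
  ProperParityColouring χ = ∀ u w → Adj G u w → χ u ≢ χ w

  bipartite⇒properParityColouring : Bipartite G → (v : Fin n) →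
                                    Σ[ χ ∈ (Fin n → Parity) ] χ v ≡ 1ℙ × ProperParityColouring χ
  bipartite⇒properParityColouring (side , bipartite) v with side v in side-v
  ... | true  = Bool→Parity ∘ side , cong Bool→Parity side-v ,
                λ u w uw → bipartite u w uw ∘ Bool→Parity-injective
  ... | false = Bool→Parity ∘ not ∘ side , cong (Bool→Parity ∘ not) side-v ,
                λ u w uw → bipartite u w uw ∘ not-injective ∘ Bool→Parity-injective

  evenSideWeighting : Connected G → (χ : Fin n → Parity) → ProperParityColouring χ →
                      ∑[ u < n ] χ u ≡ 0ℙ → Σ (EdgeWeighting G 2) (VertexColouring G)
  evenSideWeighting connected χ proper even
    with tJoin G (λ u w _ _ → connected u w) χ (λ _ _ → tt) even
  ... | F , induced , degreeParity≗χ = weighting G induced , λ u w uw → colour-≢-by-parity G induced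
          λ eq → proper u w uw (trans (sym (degreeParity≗χ u)) (trans eq (degreeParity≗χ w)))

  OutsideClosedNbhd : Fin n → Fin n → Set
  OutsideClosedNbhd v u = (u ≢ v) × ¬ Adj G v u

  module _ (v : Fin n) (degree-v≢ : ∀ x → Adj G v x → degree G v ≢ degree G x)
           (connected-H : ConnectedOn G (OutsideClosedNbhd v))
           (χ : Fin n → Parity) (proper : ProperParityColouring χ) (χv≡1 : χ v ≡ 1ℙ) where

    private
      τ : Fin n → Parity
      τ u = χ u + δ v u

      τ-off-v : ∀ {u} → u ≢ v → τ u ≡ χ u
      τ-off-v {u} u≢v = trans (cong (χ u +_) (δ-≢ (u≢v ∘ sym))) (+-identityʳ (χ u))

      τ⊆H : ∀ t → τ t ≡ 1ℙ → OutsideClosedNbhd v t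
      τ⊆H t τt≡1 = t≢v , λ vt → proper v t vt (trans χv≡1 (sym χt≡1))
        where
        t≢v : t ≢ v
        t≢v refl = contradiction (trans (sym τt≡1) (cong₂ _+_ χv≡1 (δ-≡ {a = v} refl))) λ ()
        χt≡1 : χ t ≡ 1ℙ
        χt≡1 = trans (sym (τ-off-v t≢v)) τt≡1

    oddSideWeighting : ∑[ u < n ] χ u ≡ 1ℙ → Σ (EdgeWeighting G 2) (VertexColouring G)
    oddSideWeighting odd
      with tJoin G connected-H τ τ⊆H (trans (∑-distrib-+ χ (δ v)) (cong₂ _+_ odd (∑-δ v)))
    ... | F , induced , degreeParity≗τ = weighting G induced , colouring
      where
      untouched : ∀ {x} → ¬ OutsideClosedNbhd v x → ∀ y → F x y ≡ 0ℙ
      untouched ¬H y = ⊆vertices induced _ y ¬H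

      v-untouched : ∀ y → F v y ≡ 0ℙ
      v-untouched = untouched λ H → proj₁ H refl

      nbr-untouched : ∀ {x} → Adj G v x → ∀ y → F x y ≡ 0ℙ
      nbr-untouched vx = untouched λ H → proj₂ H vx

      colouring : VertexColouring G (weighting G induced)
      colouring u w uw with u ≟ v | w ≟ v
      ... | yes refl | _        =
        colour-≢-by-degree G induced v-untouched (nbr-untouched uw) (degree-v≢ w uw)
      ... | no _     | yes refl =
        colour-≢-by-degree G induced (nbr-untouched wu) v-untouched (degree-v≢ u wu ∘ sym)
        where wu = trans (symm G w u) uw
      ... | no u≢v   | no w≢v   = colour-≢-by-parity G induced λ eq → proper u w uw (begin
        χ u              ≡⟨ sym (τ-off-v u≢v) ⟩
        τ u              ≡⟨ sym (degreeParity≗τ u) ⟩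
        degreeParity F u ≡⟨ eq ⟩
        degreeParity F w ≡⟨ degreeParity≗τ w ⟩
        τ w              ≡⟨ τ-off-v w≢v ⟩
        χ w              ∎)
        where open ≡-Reasoning

theorem2p6 : (n : ℕ) (G : Graph n) → Connected G → Bipartite G → ¬ Isomorphic G K₂
    → (v : Fin n)
    → (∀ x → Adj G v x → degree G v ≢ degree G x)
    → ConnectedOn G (λ u → (u ≢ v) × ¬ Adj G v u)
    → Σ (EdgeWeighting G 2) (λ w → VertexColouring G w)
theorem2p6 n G connected bipartite _ v degree-v≢ connected-H
  with bipartite⇒properParityColouring G bipartite v
... | χ , χv≡1 , proper with ∑[ u < n ] χ u in side-parity
...   | 0ℙ = evenSideWeighting G connected χ proper side-parity
...   | 1ℙ = oddSideWeighting G v degree-v≢ connected-H χ proper χv≡1 side-parity
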